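{- If a polygraphic program admits an additive and cartesian polygraphic interpretation that is strictly compatible with every computation $3$-cell, then it terminates.
   Context: A polygraphic program is a finite 3-polygraph with a single $0$-cell $\ast$; $k$-paths compose by $\star_j$ ($0\le j<k$), $s_j,t_j$ are $j$-source/target, and elementary $3$-paths (one $3$-cell) are rewriting steps on $2$-paths; termination means there is no infinite sequence of such steps. Its $2$-cells split into structure $2$-cells $\tau_{\xi,\zeta}:\xi\zeta\Rightarrow\zeta\xi$, $\delta_\xi:\xi\Rightarrow\xi\xi$, $\epsilon_\xi:\xi\Rightarrow\ast$, constructor $2$-cells (target a single $1$-cell) and function $2$-cells. Its $3$-cells split into structure $3$-cells — for each constructor $c:u\Rightarrow\xi$ and $1$-cell $\zeta$: $(c\star_0\zeta)\star_1\tau_{\xi,\zeta}\Rrightarrow\tau_{u,\zeta}\star_1(\zeta\star_0c)$, $(\zeta\star_0c)\star_1\tau_{\zeta,\xi}\Rrightarrow\tau_{\zeta,u}\star_1(c\star_0\zeta)$, $c\star_1\delta_\xi\Rrightarrow\delta_u\star_1(c\star_0c)$, $c\star_1\epsilon_\xi\Rrightarrow\epsilon_u$, where $\tau_{u,\zeta}:u\zeta\Rightarrow\zeta u$, $\tau_{\zeta,u}$, $\delta_u:u\Rightarrow uu$, $\epsilon_u:u\Rightarrow\ast$ are the structure $2$-paths built inductively from the structure $2$-cells — and computation $3$-cells, each with $2$-source $t\star_1f$, $t$ built from constructors only, $f$ a function $2$-cell. A functorial interpretation $\phi$ assigns to each $1$-path $u$ with $n$ $1$-cells a nonempty $\phi(u)\subseteq(\mathbb{N}\setminus\{0\})^n$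 and to each $2$-path $f:u\Rightarrow v$ a monotone $\phi(f):\phi(u)\to\phi(v)$, with $\phi(u\star_0v)=\phi(u)\times\phi(v)$, $\phi(f\star_0g)=\phi(f)\times\phi(g)$, $\phi(f\star_1g)=\phi(g)\circ\phi(f)$, identities to identities. A polygraphic interpretation $(\phi,\partial)$ adds $\partial$ assigning to each $2$-path $f$ with $1$-source $u$ a monotone $\partial f:\phi(u)\to\mathbb{N}$ with $\partial(\text{identity})=0$, $\partial(f\star_0g)(x,y)=\partial f(x)+\partial g(y)$, $\partial(f\star_1g)=\partial f+\partial g\circ\phi(f)$. It is strictly compatible with a $3$-cell $\alpha$ if $\phi(s_2\alpha)\ge\phi(t_2\alpha)$ and $\partial(s_2\alpha)>\partial(t_2\alpha)$ pointwise. It is additive if each constructor $c$ of arity $n$ has an integer $c_c\ge1$ with $\phi(c)(x)=x_1+\dots+x_n+c_c$; cartesian if $\phi(\delta_\xi)(x)=(x,x)$, $\phi(\tau_{\xi,\zeta})(x,y)=(y,x)$, and $\partial$ sends every constructor and structure $2$-cell to $0$. -}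

module Defs where

open import Data.Nat using (ℕ; zero; suc; _+_; _≤_; _<_)
open import Data.Fin using (Fin)
open import Data.List using (List; []; _∷_; _++_; [_])
open import Data.List.Properties using (++-assoc)
open import Data.List.Relation.Unary.All using (All; []; _∷_)
open import Data.List.Relation.Unary.All.Properties using (++⁺; ++⁻)
open import Data.List.Relation.Binary.Pointwise using (Pointwise)
open import Data.Product using (Σ; _×_; _,_; proj₁; proj₂)
open import Relation.Binary.PropositionalEquality using (_≡_; refl; cong; subst)
open import Relation.Nullary using (¬_)

-- Generators of a polygraphic program up to dimension 2.
-- One 0-cell; 1-cells are Fin n1; 1-paths are lists of 1-cells
-- (the free monoid, ⋆0 = _++_, identity of ∗ = []).

record Sig2 : Set where
  field
    n1   : ℕ
    nC   : ℕ
    csrc : Fin nC → List (Fin n1)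
    ctgt : Fin nC → Fin n1
    nF   : ℕ
    fsrc : Fin nF → List (Fin n1)
    ftgt : Fin nF → List (Fin n1)

module _ (S : Sig2) where
  open Sig2 S

  C1 : Set
  C1 = Fin n1

  data C2 : Set where
    τ   : C1 → C1 → C2
    δ   : C1 → C2
    ε   : C1 → C2
    con : Fin nC → C2
    fun : Fin nF → C2

  src2 : C2 → List C1
  src2 (τ ξ ζ) = ξ ∷ ζ ∷ []
  src2 (δ ξ)   = ξ ∷ []
  src2 (ε ξ)   = ξ ∷ []
  src2 (con c) = csrc c
  src2 (fun f) = fsrc f

  tgt2 : C2 → List C1
  tgt2 (τ ξ ζ) = ζ ∷ ξ ∷ []
  tgt2 (δ ξ)   = ξ ∷ ξ ∷ []
  tgt2 (ε ξ)   = []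
  tgt2 (con c) = ctgt c ∷ []
  tgt2 (fun f) = ftgt f

  infixr 6 _⋆₀_
  infixr 5 _⋆₁_
  data Path2 : List C1 → List C1 → Set where
    gen  : (φ : C2) → Path2 (src2 φ) (tgt2 φ)
    idp  : (u : List C1) → Path2 u u
    _⋆₀_ : ∀ {u v u' v'} → Path2 u v → Path2 u' v' → Path2 (u ++ u') (v ++ v')
    _⋆₁_ : ∀ {u v w} → Path2 u v → Path2 v w → Path2 u w

  -- The axioms of (strict) 2-categories: 2-paths are terms modulo _≈_.
  -- Heterogeneous in the boundaries so that associativity of ⋆₀ can be stated.
  infix 4 _≈_
  data _≈_ : ∀ {u v u' v'} → Path2 u v → Path2 u' v' → Set where
    ≈refl  : ∀ {u v} {f : Path2 u v} → f ≈ f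
    ≈sym   : ∀ {u v u' v'} {f : Path2 u v} {g : Path2 u' v'} → f ≈ g → g ≈ f
    ≈trans : ∀ {u v u' v' u'' v''} {f : Path2 u v} {g : Path2 u' v'} {h : Path2 u'' v''}
             → f ≈ g → g ≈ h → f ≈ h
    cong₀  : ∀ {a b c d a' b' c' d'} {f : Path2 a b} {g : Path2 c d}
               {f' : Path2 a' b'} {g' : Path2 c' d'}
             → f ≈ f' → g ≈ g' → (f ⋆₀ g) ≈ (f' ⋆₀ g')
    cong₁  : ∀ {a b c a' b' c'} {f : Path2 a b} {g : Path2 b c}
               {f' : Path2 a' b'} {g' : Path2 b' c'}
             → f ≈ f' → g ≈ g' → (f ⋆₁ g) ≈ (f' ⋆₁ g')
    assoc₀ : ∀ {a b c d e h} {f : Path2 a b} {g : Path2 c d} {k : Path2 e h}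
             → ((f ⋆₀ g) ⋆₀ k) ≈ (f ⋆₀ (g ⋆₀ k))
    assoc₁ : ∀ {a b c d} {f : Path2 a b} {g : Path2 b c} {k : Path2 c d}
             → ((f ⋆₁ g) ⋆₁ k) ≈ (f ⋆₁ (g ⋆₁ k))
    unit₀ˡ : ∀ {a b} {f : Path2 a b} → (idp [] ⋆₀ f) ≈ f
    unit₀ʳ : ∀ {a b} {f : Path2 a b} → (f ⋆₀ idp []) ≈ f
    unit₁ˡ : ∀ {a b} {f : Path2 a b} → (idp a ⋆₁ f) ≈ f
    unit₁ʳ : ∀ {a b} {f : Path2 a b} → (f ⋆₁ idp b) ≈ f
    idp₀   : ∀ {u v} → (idp u ⋆₀ idp v) ≈ idp (u ++ v)
    exch   : ∀ {a b c a' b' c'} {f : Path2 a b} {g : Path2 b c}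
               {f' : Path2 a' b'} {g' : Path2 b' c'}
             → ((f ⋆₁ g) ⋆₀ (f' ⋆₁ g')) ≈ ((f ⋆₀ f') ⋆₁ (g ⋆₀ g'))

  data ConstrOnly : ∀ {u v} → Path2 u v → Set where
    c-gen : (c : Fin nC) → ConstrOnly (gen (con c))
    c-idp : (u : List C1) → ConstrOnly (idp u)
    c-⋆₀  : ∀ {u v u' v'} {f : Path2 u v} {g : Path2 u' v'}
            → ConstrOnly f → ConstrOnly g → ConstrOnly (f ⋆₀ g)
    c-⋆₁  : ∀ {u v w} {f : Path2 u v} {g : Path2 v w}
            → ConstrOnly f → ConstrOnly g → ConstrOnly (f ⋆₁ g)

  castT : ∀ {u v v'} → v ≡ v' → Path2 u v → Path2 u v'
  castT {u} p f = subst (Path2 u) p f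

  ε* : (u : List C1) → Path2 u []
  ε* []      = idp []
  ε* (ξ ∷ u) = gen (ε ξ) ⋆₀ ε* u

  τ*ˡ : (u : List C1) (ζ : C1) → Path2 (u ++ [ ζ ]) (ζ ∷ u)
  τ*ˡ []      ζ = idp [ ζ ]
  τ*ˡ (ξ ∷ u) ζ = (idp [ ξ ] ⋆₀ τ*ˡ u ζ) ⋆₁ (gen (τ ξ ζ) ⋆₀ idp u)

  τ*ʳ : (ζ : C1) (u : List C1) → Path2 (ζ ∷ u) (u ++ [ ζ ])
  τ*ʳ ζ []      = idp [ ζ ]
  τ*ʳ ζ (ξ ∷ u) = (gen (τ ζ ξ) ⋆₀ idp u) ⋆₁ (idp [ ξ ] ⋆₀ τ*ʳ ζ u)

  δ* : (u : List C1) → Path2 u (u ++ u)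
  δ* []      = idp []
  δ* (ξ ∷ u) = (gen (δ ξ) ⋆₀ δ* u)
               ⋆₁ castT (cong (ξ ∷_) (++-assoc u [ ξ ] u))
                        (idp [ ξ ] ⋆₀ (τ*ʳ ξ u ⋆₀ idp u))

  record Cell3 : Set where
    constructor mk3
    field
      s1 t1 : List C1
      src   : Path2 s1 t1
      tgt   : Path2 s1 t1

  str-τl : Fin nC → C1 → Cell3
  str-τl c ζ = mk3 (csrc c ++ [ ζ ]) (ζ ∷ ctgt c ∷ [])
    ((gen (con c) ⋆₀ idp [ ζ ]) ⋆₁ gen (τ (ctgt c) ζ))
    (τ*ˡ (csrc c) ζ ⋆₁ (idp [ ζ ] ⋆₀ gen (con c)))

  str-τr : Fin nC → C1 → Cell3
  str-τr c ζ = mk3 (ζ ∷ csrc c) (ctgt c ∷ ζ ∷ [])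
    ((idp [ ζ ] ⋆₀ gen (con c)) ⋆₁ gen (τ ζ (ctgt c)))
    (τ*ʳ ζ (csrc c) ⋆₁ (gen (con c) ⋆₀ idp [ ζ ]))

  str-δ : Fin nC → Cell3
  str-δ c = mk3 (csrc c) (ctgt c ∷ ctgt c ∷ [])
    (gen (con c) ⋆₁ gen (δ (ctgt c)))
    (δ* (csrc c) ⋆₁ (gen (con c) ⋆₀ gen (con c)))

  str-ε : Fin nC → Cell3
  str-ε c = mk3 (csrc c) []
    (gen (con c) ⋆₁ gen (ε (ctgt c)))
    (ε* (csrc c))

  record CompCell : Set where
    field
      dom  : List C1
      fn   : Fin nF
      lhsT : Path2 dom (fsrc fn)
      lhsT-constr : ConstrOnly lhsT
      rhs  : Path2 dom (ftgt fn)

  compCell3 : CompCell → Cell3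
  compCell3 r = mk3 dom (ftgt fn) (lhsT ⋆₁ gen (fun fn)) rhs
    where open CompCell r

record Program : Set where
  field
    sig   : Sig2
    nR    : ℕ
    rules : Fin nR → CompCell sig

module _ (P : Program) where
  open Program P

  data C3 : Set where
    s-τl : Fin (Sig2.nC sig) → C1 sig → C3
    s-τr : Fin (Sig2.nC sig) → C1 sig → C3
    s-δ  : Fin (Sig2.nC sig) → C3
    s-ε  : Fin (Sig2.nC sig) → C3
    comp : Fin nR → C3

  cell3 : C3 → Cell3 sig
  cell3 (s-τl c ζ) = str-τl sig c ζ
  cell3 (s-τr c ζ) = str-τr sig c ζ
  cell3 (s-δ c)    = str-δ sig c
  cell3 (s-ε c)    = str-ε sig c
  cell3 (comp r)   = compCell3 sig (rules r)

  whisk : ∀ {a b} (w₁ : List (C1 sig)) → Path2 sig a b → (w₂ : List (C1 sig))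
          → Path2 sig (w₁ ++ a ++ w₂) (w₁ ++ b ++ w₂)
  whisk w₁ f w₂ = idp w₁ ⋆₀ (f ⋆₀ idp w₂)

  data Step {u v : List (C1 sig)} : Path2 sig u v → Path2 sig u v → Set where
    step : (α : C3) (w₁ w₂ : List (C1 sig))
           (g₁ : Path2 sig u (w₁ ++ Cell3.s1 (cell3 α) ++ w₂))
           (g₂ : Path2 sig (w₁ ++ Cell3.t1 (cell3 α) ++ w₂) v)
           {h h' : Path2 sig u v}
         → _≈_ sig h  (g₁ ⋆₁ (whisk w₁ (Cell3.src (cell3 α)) w₂ ⋆₁ g₂))
         → _≈_ sig h' (g₁ ⋆₁ (whisk w₁ (Cell3.tgt (cell3 α)) w₂ ⋆₁ g₂))
         → Step h h'

  Terminates : Set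
  Terminates = ∀ (u v : List (C1 sig)) →
    ¬ (Σ (ℕ → Path2 sig u v) λ s → ∀ n → Step (s n) (s (suc n)))

module _ (S : Sig2) where
  open Sig2 S

  -- elements of φ(u) = φ(ξ₁) × … × φ(ξₙ), given φ on 1-cells
  Elt : (C1 S → ℕ → Set) → List (C1 S) → Set
  Elt X u = All (λ ξ → Σ ℕ (X ξ)) u

  vals : ∀ {X u} → Elt X u → List ℕ
  vals []             = []
  vals ((x , _) ∷ xs) = x ∷ vals xs

  sumE : ∀ {X u} → Elt X u → ℕ
  sumE []             = 0
  sumE ((x , _) ∷ xs) = x + sumE xs

  _≤E_ : ∀ {X u} → Elt X u → Elt X u → Set
  x ≤E y = Pointwise _≤_ (vals x) (vals y)

  record Interp : Set₁ where
    field
      X      : C1 S → ℕ → Set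
      X-pos  : ∀ ξ x → X ξ x → 1 ≤ x
      X-ne   : ∀ ξ → Σ ℕ (X ξ)
      φ₂     : (a : C2 S) → Elt X (src2 S a) → Elt X (tgt2 S a)
      φ₂-mono : ∀ a {x y} → x ≤E y → φ₂ a x ≤E φ₂ a y
      ∂₂     : (a : C2 S) → Elt X (src2 S a) → ℕ
      ∂₂-mono : ∀ a {x y} → x ≤E y → ∂₂ a x ≤ ∂₂ a y

    φ : ∀ {u v} → Path2 S u v → Elt X u → Elt X v
    φ (gen a)          x = φ₂ a x
    φ (idp u)          x = x
    φ (_⋆₀_ {u} f g)   x = let (x₁ , x₂) = ++⁻ u x in ++⁺ (φ f x₁) (φ g x₂)
    φ (f ⋆₁ g)         x = φ g (φ f x)

    ∂ : ∀ {u v} → Path2 S u v → Elt X u → ℕ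
    ∂ (gen a)          x = ∂₂ a x
    ∂ (idp u)          x = 0
    ∂ (_⋆₀_ {u} f g)   x = let (x₁ , x₂) = ++⁻ u x in ∂ f x₁ + ∂ g x₂
    ∂ (f ⋆₁ g)         x = ∂ f x + ∂ g (φ f x)

  open Interp

  Additive : Interp → Set
  Additive I = ∀ (c : Fin nC) → Σ ℕ λ k → 1 ≤ k ×
    (∀ x → vals (φ₂ I (con c) x) ≡ (sumE x + k) ∷ [])

  Cartesian : Interp → Set
  Cartesian I =
      (∀ ξ x → vals (φ₂ I (δ ξ) x) ≡ vals x ++ vals x)
    × (∀ ξ ζ (x : Σ ℕ (X I ξ)) (y : Σ ℕ (X I ζ)) →
         vals (φ₂ I (τ ξ ζ) (x ∷ y ∷ [])) ≡ proj₁ y ∷ proj₁ x ∷ [])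
    × (∀ c x → ∂₂ I (con c) x ≡ 0)
    × (∀ ξ ζ x → ∂₂ I (τ ξ ζ) x ≡ 0)
    × (∀ ξ x → ∂₂ I (δ ξ) x ≡ 0)
    × (∀ ξ x → ∂₂ I (ε ξ) x ≡ 0)

  StrictlyCompatible : Interp → Cell3 S → Set
  StrictlyCompatible I α =
      (∀ x → φ I (Cell3.tgt α) x ≤E φ I (Cell3.src α) x)
    × (∀ x → ∂ I (Cell3.tgt α) x < ∂ I (Cell3.src α) x)

module Submission where

-- Two measures are combined lexicographically.  The given interpretation I
-- decreases ∂ strictly along computation steps.  Along a structure step, which
-- permutes, duplicates or erases a constructor term, additivity and
-- cartesianity make both sides act identically on values, and ∂_I vanishes on
-- both, so ∂_I does not increase.  A fixed "size" interpretation, charging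
-- x·y for swapping values x and y, x² for duplicating x and x for erasing it,
-- decreases strictly along every structure step, because a constructor's
-- output exceeds the sum of its inputs.  Both measures are invariant under the
-- 2-category axioms and, by monotonicity, compatible with whiskering and
-- composition, so every rewriting step decreases (∂_I , ∂_size) in a
-- well-founded lexicographic order on ℕ × ℕ.

open import Defs

open import Data.Fin using (Fin)
open import Data.List using (List; []; _∷_; _++_; [_]; map)
open import Data.List.Properties using (++-assoc; ++-identityʳ; ∷-injectiveˡ; ∷-injectiveʳ; map-id)
open import Data.List.Relation.Binary.Pointwise as Pointwise
  using (Pointwise; []; _∷_; Pointwise-≡⇒≡; ≡⇒Pointwise-≡)
open import Data.List.Relation.Unary.All as All using (All; []; _∷_)
open import Data.List.Relation.Unary.All.Properties using (++⁺; ++⁻; ++↔)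
open import Data.Nat using (ℕ; suc; _+_; _*_; _≤_; _<_; z≤n; z<s; >-nonZero)
open import Data.Nat.Induction using (<-wellFounded)
open import Data.Nat.ListAction using (sum)
open import Data.Nat.Properties
open import Algebra.Properties.CommutativeSemigroup +-commutativeSemigroup
  using () renaming (interchange to +-interchange)
open import Data.Nat.Tactic.RingSolver using (solve-∀)
open import Data.Product using (Σ; _×_; _,_; proj₁; proj₂; ∃-syntax)
open import Data.Product.Relation.Binary.Lex.Strict using (×-Lex; ×-wellFounded')
open import Data.Sum as Sum using (_⊎_; inj₁; inj₂)
open import Function using (_∘_; id; Inverse)
open import Induction.InfiniteDescent using (Descent; InfiniteDescendingSequenceFrom; descent∧wf⇒empty)
open import Induction.WellFounded using (WellFounded)
open import Relation.Binary using (Rel)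
open import Relation.Binary.PropositionalEquality
  using (_≡_; refl; sym; trans; cong; cong₂; subst; subst₂; module ≡-Reasoning)
open import Relation.Nullary using (¬_)

module Elements {S : Sig2} {X : C1 S → ℕ → Set} where
  private
    E : List (C1 S) → Set
    E = Elt S X

  -- Elements carry proofs of membership in φ(ξ), so they are compared through
  -- their lists of values.
  infix 4 _≐_
  _≐_ : ∀ {u u'} → E u → E u' → Set
  x ≐ y = vals S x ≡ vals S y

  prefix : ∀ u {w} → E (u ++ w) → E u
  prefix u x = proj₁ (++⁻ u x)

  suffix : ∀ u {w} → E (u ++ w) → E w
  suffix u x = proj₂ (++⁻ u x)

  ++⁺-prefix-suffix : ∀ u {w} (x : E (u ++ w)) → ++⁺ (prefix u x) (suffix u x) ≡ x
  ++⁺-prefix-suffix u = Inverse.strictlyInverseˡ (++↔ {xs = u})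

  ++⁻-++⁺ : ∀ {u w} (a : E u) (b : E w) → ++⁻ u (++⁺ a b) ≡ (a , b)
  ++⁻-++⁺ a b = Inverse.strictlyInverseʳ ++↔ (a , b)

  ++⁺-elim : ∀ u {w} (P : E (u ++ w) → Set) → (∀ a b → P (++⁺ a b)) → ∀ x → P x
  ++⁺-elim u P p x = subst P (++⁺-prefix-suffix u x) (p (prefix u x) (suffix u x))

  vals-++⁺ : ∀ {u w} (a : E u) (b : E w) → vals S (++⁺ a b) ≡ vals S a ++ vals S b
  vals-++⁺ []      b = refl
  vals-++⁺ (p ∷ a) b = cong (proj₁ p ∷_) (vals-++⁺ a b)

  ++⁺-≐ : ∀ {u u' w w'} {a : E u} {a' : E u'} {b : E w} {b' : E w'} →
          a ≐ a' → b ≐ b' → ++⁺ a b ≐ ++⁺ a' b'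
  ++⁺-≐ {a = a} {a'} {b} {b'} a≐a' b≐b' =
    trans (vals-++⁺ a b) (trans (cong₂ _++_ a≐a' b≐b') (sym (vals-++⁺ a' b')))

  ++⁺-assoc-≐ : ∀ {u v w} (a : E u) (b : E v) (c : E w) → ++⁺ (++⁺ a b) c ≐ ++⁺ a (++⁺ b c)
  ++⁺-assoc-≐ []      b c = refl
  ++⁺-assoc-≐ (p ∷ a) b c = cong (proj₁ p ∷_) (++⁺-assoc-≐ a b c)

  ++⁺-identityʳ-≐ : ∀ {u} (a : E u) (b : E []) → ++⁺ a b ≐ a
  ++⁺-identityʳ-≐ a [] = trans (vals-++⁺ a []) (++-identityʳ (vals S a))

  split-≐ : ∀ u {w w'} {x : E (u ++ w)} {y : E (u ++ w')} → x ≐ y →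
            prefix u x ≐ prefix u y × suffix u x ≐ suffix u y
  split-≐ []      x≐y = refl , x≐y
  split-≐ (_ ∷ u) {x = p ∷ x} {q ∷ y} x≐y =
    let (≐₁ , ≐₂) = split-≐ u (∷-injectiveʳ x≐y) in cong₂ _∷_ (∷-injectiveˡ x≐y) ≐₁ , ≐₂

  split-assoc-≐ : ∀ u v {w} {x : E ((u ++ v) ++ w)} {y : E (u ++ (v ++ w))} → x ≐ y →
                  prefix u (prefix (u ++ v) x) ≐ prefix u y
                  × suffix u (prefix (u ++ v) x) ≐ prefix v (suffix u y)
                  × suffix (u ++ v) x ≐ suffix v (suffix u y)
  split-assoc-≐ []      v x≐y = refl , split-≐ v x≐y
  split-assoc-≐ (_ ∷ u) v {x = p ∷ x} {q ∷ y} x≐y =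
    let (≐₁ , ≐₂ , ≐₃) = split-assoc-≐ u v (∷-injectiveʳ x≐y) in
    cong₂ _∷_ (∷-injectiveˡ x≐y) ≐₁ , ≐₂ , ≐₃

  prefix-identityʳ-≐ : ∀ u (x : E (u ++ [])) → prefix u x ≐ x
  prefix-identityʳ-≐ []      []      = refl
  prefix-identityʳ-≐ (_ ∷ u) (p ∷ x) = cong (proj₁ p ∷_) (prefix-identityʳ-≐ u x)

  E[]-≐ : (x y : E []) → x ≐ y
  E[]-≐ [] [] = refl

  infix 4 _⊑_
  _⊑_ : ∀ {u} → E u → E u → Set
  _⊑_ = _≤E_ S

  ⊑-refl : ∀ {u} {x : E u} → x ⊑ x
  ⊑-refl = Pointwise.refl ≤-refl

  ≐⇒⊑ : ∀ {u} {x y : E u} → x ≐ y → x ⊑ y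
  ≐⇒⊑ = Pointwise.map ≤-reflexive ∘ ≡⇒Pointwise-≡

  ⊑-antisym : ∀ {u} {x y : E u} → x ⊑ y → y ⊑ x → x ≐ y
  ⊑-antisym x≤y y≤x = Pointwise-≡⇒≡ (Pointwise.antisymmetric ≤-antisym x≤y y≤x)

  ++⁺-mono : ∀ {u w} {a a' : E u} {b b' : E w} →
             a ⊑ a' → b ⊑ b' → ++⁺ a b ⊑ ++⁺ a' b'
  ++⁺-mono {a = a} {a'} {b} {b'} a≤a' b≤b' =
    subst₂ (Pointwise _≤_) (sym (vals-++⁺ a b)) (sym (vals-++⁺ a' b')) (Pointwise.++⁺ a≤a' b≤b')

  split-mono : ∀ u {w} {x y : E (u ++ w)} → x ⊑ y →
               prefix u x ⊑ prefix u y × suffix u x ⊑ suffix u y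
  split-mono []      x≤y = [] , x≤y
  split-mono (_ ∷ u) {x = p ∷ x} {q ∷ y} (p≤q ∷ x≤y) =
    let (≤₁ , ≤₂) = split-mono u x≤y in p≤q ∷ ≤₁ , ≤₂

≈-boundaries : ∀ {S u v u' v'} {f : Path2 S u v} {g : Path2 S u' v'} → _≈_ S f g → u ≡ u' × v ≡ v'
≈-boundaries ≈refl       = refl , refl
≈-boundaries (≈sym p)    = let (eu , ev) = ≈-boundaries p in sym eu , sym ev
≈-boundaries (≈trans p q) =
  let (eu , ev) = ≈-boundaries p ; (eu' , ev') = ≈-boundaries q in trans eu eu' , trans ev ev'
≈-boundaries (cong₀ p q) =
  let (eu , ev) = ≈-boundaries p ; (eu' , ev') = ≈-boundaries q in cong₂ _++_ eu eu' , cong₂ _++_ ev ev'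
≈-boundaries (cong₁ p q) = proj₁ (≈-boundaries p) , proj₂ (≈-boundaries q)
≈-boundaries (assoc₀ {a} {b} {c} {d} {e} {h}) = ++-assoc a c e , ++-assoc b d h
≈-boundaries assoc₁      = refl , refl
≈-boundaries unit₀ˡ      = refl , refl
≈-boundaries (unit₀ʳ {a} {b}) = ++-identityʳ a , ++-identityʳ b
≈-boundaries unit₁ˡ      = refl , refl
≈-boundaries unit₁ʳ      = refl , refl
≈-boundaries idp₀        = refl , refl
≈-boundaries exch        = refl , refl

module Functoriality {S : Sig2} (K : Interp S) where
  open Interp K
  open Elements {S} {X}

  private
    E : List (C1 S) → Set
    E = Elt S X

  φ-mono : ∀ {u v} (f : Path2 S u v) {x y} → x ⊑ y → φ f x ⊑ φ f y
  φ-mono (gen a)        = φ₂-mono a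
  φ-mono (idp u)        = id
  φ-mono (_⋆₀_ {u} f g) x≤y =
    let (≤₁ , ≤₂) = split-mono u x≤y in ++⁺-mono (φ-mono f ≤₁) (φ-mono g ≤₂)
  φ-mono (f ⋆₁ g)       = φ-mono g ∘ φ-mono f

  ∂-mono : ∀ {u v} (f : Path2 S u v) {x y} → x ⊑ y → ∂ f x ≤ ∂ f y
  ∂-mono (gen a)        = ∂₂-mono a
  ∂-mono (idp u)        = λ _ → z≤n
  ∂-mono (_⋆₀_ {u} f g) x≤y =
    let (≤₁ , ≤₂) = split-mono u x≤y in +-mono-≤ (∂-mono f ≤₁) (∂-mono g ≤₂)
  ∂-mono (f ⋆₁ g) x≤y   = +-mono-≤ (∂-mono f x≤y) (∂-mono g (φ-mono f x≤y))

  φ-resp-≐ : ∀ {u v} (f : Path2 S u v) {x y} → x ≐ y → φ f x ≐ φ f y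
  φ-resp-≐ f x≐y = ⊑-antisym (φ-mono f (≐⇒⊑ x≐y)) (φ-mono f (≐⇒⊑ (sym x≐y)))

  ∂-resp-≐ : ∀ {u v} (f : Path2 S u v) {x y} → x ≐ y → ∂ f x ≡ ∂ f y
  ∂-resp-≐ f x≐y = ≤-antisym (∂-mono f (≐⇒⊑ x≐y)) (∂-mono f (≐⇒⊑ (sym x≐y)))

  φ-⋆₀-++⁺ : ∀ {u v u' v'} (f : Path2 S u v) (g : Path2 S u' v') (a : E u) (b : E u') →
             φ (f ⋆₀ g) (++⁺ a b) ≡ ++⁺ (φ f a) (φ g b)
  φ-⋆₀-++⁺ f g a b = cong (λ (a , b) → ++⁺ (φ f a) (φ g b)) (++⁻-++⁺ a b)

  ∂-⋆₀-++⁺ : ∀ {u v u' v'} (f : Path2 S u v) (g : Path2 S u' v') (a : E u) (b : E u') →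
             ∂ (f ⋆₀ g) (++⁺ a b) ≡ ∂ f a + ∂ g b
  ∂-⋆₀-++⁺ f g a b = cong (λ (a , b) → ∂ f a + ∂ g b) (++⁻-++⁺ a b)

  φ-resp-≈ : ∀ {u v u' v'} {f : Path2 S u v} {g : Path2 S u' v'} → _≈_ S f g →
             ∀ {x x'} → x ≐ x' → φ f x ≐ φ g x'
  φ-resp-≈ {f = f} ≈refl   = φ-resp-≐ f
  φ-resp-≈ (≈sym p) x≐x'   = sym (φ-resp-≈ p (sym x≐x'))
  φ-resp-≈ (≈trans p q) x≐x' with ≈-boundaries p
  ... | refl , _ = trans (φ-resp-≈ p refl) (φ-resp-≈ q x≐x')
  φ-resp-≈ (cong₀ {a} p q) x≐x' with ≈-boundaries p
  ... | refl , _ = let (≐₁ , ≐₂) = split-≐ a x≐x' in ++⁺-≐ (φ-resp-≈ p ≐₁) (φ-resp-≈ q ≐₂)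
  φ-resp-≈ (cong₁ p q)     = φ-resp-≈ q ∘ φ-resp-≈ p
  φ-resp-≈ (assoc₀ {a} {c = c} {f = f} {g} {k}) {x} x≐x' =
    let (≐₁ , ≐₂ , ≐₃) = split-assoc-≐ a c x≐x'
        x₁₂ = prefix (a ++ c) x
    in
    trans (++⁺-assoc-≐ (φ f (prefix a x₁₂)) (φ g (suffix a x₁₂)) (φ k (suffix (a ++ c) x)))
          (++⁺-≐ (φ-resp-≐ f ≐₁) (++⁺-≐ (φ-resp-≐ g ≐₂) (φ-resp-≐ k ≐₃)))
  φ-resp-≈ (assoc₁ {f = f} {g} {k}) = φ-resp-≐ (f ⋆₁ g ⋆₁ k)
  φ-resp-≈ (unit₀ˡ {f = f}) = φ-resp-≐ f
  φ-resp-≈ (unit₀ʳ {a} {f = f}) {x} x≐x' =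
    trans (++⁺-identityʳ-≐ _ _) (φ-resp-≐ f (trans (prefix-identityʳ-≐ a x) x≐x'))
  φ-resp-≈ (unit₁ˡ {f = f}) = φ-resp-≐ f
  φ-resp-≈ (unit₁ʳ {f = f}) = φ-resp-≐ f
  φ-resp-≈ (idp₀ {u}) {x} x≐x' = trans (cong (vals S) (++⁺-prefix-suffix u x)) x≐x'
  φ-resp-≈ (exch {a} {f = f} {g} {f'} {g'}) x≐x' =
    let (≐₁ , ≐₂) = split-≐ a x≐x' in
    trans (++⁺-≐ (φ-resp-≐ (f ⋆₁ g) ≐₁) (φ-resp-≐ (f' ⋆₁ g') ≐₂))
          (sym (cong (vals S) (φ-⋆₀-++⁺ g g' _ _)))

  ∂-resp-≈ : ∀ {u v u' v'} {f : Path2 S u v} {g : Path2 S u' v'} → _≈_ S f g →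
             ∀ {x x'} → x ≐ x' → ∂ f x ≡ ∂ g x'
  ∂-resp-≈ {f = f} ≈refl   = ∂-resp-≐ f
  ∂-resp-≈ (≈sym p) x≐x'   = sym (∂-resp-≈ p (sym x≐x'))
  ∂-resp-≈ (≈trans p q) x≐x' with ≈-boundaries p
  ... | refl , _ = trans (∂-resp-≈ p refl) (∂-resp-≈ q x≐x')
  ∂-resp-≈ (cong₀ {a} p q) x≐x' with ≈-boundaries p
  ... | refl , _ = let (≐₁ , ≐₂) = split-≐ a x≐x' in cong₂ _+_ (∂-resp-≈ p ≐₁) (∂-resp-≈ q ≐₂)
  ∂-resp-≈ (cong₁ p q) x≐x' = cong₂ _+_ (∂-resp-≈ p x≐x') (∂-resp-≈ q (φ-resp-≈ p x≐x'))
  ∂-resp-≈ (assoc₀ {a} {c = c} {f = f} {g} {k}) {x} x≐x' =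
    let (≐₁ , ≐₂ , ≐₃) = split-assoc-≐ a c x≐x'
        x₁₂ = prefix (a ++ c) x
    in
    trans (+-assoc (∂ f (prefix a x₁₂)) (∂ g (suffix a x₁₂)) (∂ k (suffix (a ++ c) x)))
          (cong₂ _+_ (∂-resp-≐ f ≐₁) (cong₂ _+_ (∂-resp-≐ g ≐₂) (∂-resp-≐ k ≐₃)))
  ∂-resp-≈ (assoc₁ {f = f} {g} {k}) {x' = x'} x≐x' =
    trans (∂-resp-≐ ((f ⋆₁ g) ⋆₁ k) x≐x') (+-assoc (∂ f x') _ _)
  ∂-resp-≈ (unit₀ˡ {f = f}) = ∂-resp-≐ f
  ∂-resp-≈ (unit₀ʳ {a} {f = f}) {x} x≐x' =
    trans (+-identityʳ _) (∂-resp-≐ f (trans (prefix-identityʳ-≐ a x) x≐x'))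
  ∂-resp-≈ (unit₁ˡ {f = f}) = ∂-resp-≐ f
  ∂-resp-≈ (unit₁ʳ {f = f}) x≐x' = trans (+-identityʳ _) (∂-resp-≐ f x≐x')
  ∂-resp-≈ idp₀ _ = refl
  ∂-resp-≈ (exch {a} {f = f} {g} {f'} {g'}) {x' = x'} x≐x' =
    let (≐₁ , ≐₂) = split-≐ a x≐x'
        y₁ = prefix a x' ; y₂ = suffix a x'
    in
    trans (cong₂ _+_ (∂-resp-≐ (f ⋆₁ g) ≐₁) (∂-resp-≐ (f' ⋆₁ g') ≐₂))
          (trans (+-interchange (∂ f y₁) (∂ g (φ f y₁)) (∂ f' y₂) (∂ g' (φ f' y₂)))
                 (cong (∂ f y₁ + ∂ f' y₂ +_) (sym (∂-⋆₀-++⁺ g g' (φ f y₁) (φ f' y₂)))))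

  φ-castT : ∀ {u v v'} (e : v ≡ v') (f : Path2 S u v) x → φ (castT S e f) x ≐ φ f x
  φ-castT refl f x = refl

  ∂-castT : ∀ {u v v'} (e : v ≡ v') (f : Path2 S u v) x → ∂ (castT S e f) x ≡ ∂ f x
  ∂-castT refl f x = refl

  Compatible : (ℕ → ℕ → Set) → Cell3 S → Set
  Compatible _◁_ α = (∀ x → φ (Cell3.tgt α) x ⊑ φ (Cell3.src α) x)
                   × (∀ x → ∂ (Cell3.tgt α) x ◁ ∂ (Cell3.src α) x)

rule : ∀ {P u v} {h h' : Path2 (Program.sig P) u v} → Step P h h' → C3 P
rule (step α _ _ _ _ _ _) = α

module Rewriting (P : Program) (K : Interp (Program.sig P)) where
  open Program P using (sig)
  open Interp K
  open Elements {sig} {X}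
  open Functoriality K

  whisk-mono : ∀ {a b} (w₁ w₂ : List (C1 sig)) (s t : Path2 sig a b) →
               (∀ z → φ t z ⊑ φ s z) →
               ∀ y → φ (whisk P w₁ t w₂) y ⊑ φ (whisk P w₁ s w₂) y
  whisk-mono {a} w₁ w₂ s t t≤s y =
    let z = suffix w₁ y in
    ++⁺-mono {a = prefix w₁ y} ⊑-refl (++⁺-mono {b = suffix a z} (t≤s (prefix a z)) ⊑-refl)

  ∂-in-context : ∀ {a b u v} (w₁ w₂ : List (C1 sig)) (f : Path2 sig a b)
                 (g₁ : Path2 sig u (w₁ ++ a ++ w₂)) (g₂ : Path2 sig (w₁ ++ b ++ w₂) v) x →
                 let y = φ g₁ x in
                 ∂ (g₁ ⋆₁ (whisk P w₁ f w₂ ⋆₁ g₂)) x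
                   ≡ ∂ g₁ x + (∂ f (prefix a (suffix w₁ y)) + ∂ g₂ (φ (whisk P w₁ f w₂) y))
  ∂-in-context {a} w₁ w₂ f g₁ g₂ x =
    let y = φ g₁ x in
    cong (λ n → ∂ g₁ x + (n + ∂ g₂ (φ (whisk P w₁ f w₂) y)))
         (+-identityʳ (∂ f (prefix a (suffix w₁ y))))

  ∂-step : ∀ {_◁_ : ℕ → ℕ → Set} →
           (∀ {a b c d} m → a ◁ b → c ≤ d → (m + (a + c)) ◁ (m + (b + d))) →
           ∀ {u v} {h h' : Path2 sig u v} (s : Step P h h') →
           Compatible _◁_ (cell3 P (rule s)) → ∀ x → ∂ h' x ◁ ∂ h x
  ∂-step {_◁_} ◁-mono (step α w₁ w₂ g₁ g₂ h≈ h'≈) (t≤s , t◁s) x =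
    subst₂ _◁_ (sym (trans (∂-resp-≈ h'≈ refl) (∂-in-context w₁ w₂ t g₁ g₂ x)))
               (sym (trans (∂-resp-≈ h≈ refl) (∂-in-context w₁ w₂ s g₁ g₂ x)))
               (◁-mono (∂ g₁ x) (t◁s _) (∂-mono g₂ (whisk-mono w₁ w₂ s t t≤s (φ g₁ x))))
    where
    s = Cell3.src (cell3 P α)
    t = Cell3.tgt (cell3 P α)

record StructurallyCompatible {S : Sig2} (K : Interp S) (_◁_ : ℕ → ℕ → Set) : Set where
  field
    τˡ-cell : ∀ c ζ → Functoriality.Compatible K _◁_ (str-τl S c ζ)
    τʳ-cell : ∀ c ζ → Functoriality.Compatible K _◁_ (str-τr S c ζ)
    δ-cell  : ∀ c → Functoriality.Compatible K _◁_ (str-δ S c)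
    ε-cell  : ∀ c → Functoriality.Compatible K _◁_ (str-ε S c)

-- ∂ of the structure 2-paths τ_{u,b}, τ_{b,u}, δ_u and ε_u as a function of
-- the values of their input, when ∂ of τ, δ and ε is given by cτ, cδ and cε.
τ*ˡ-cost : (ℕ → ℕ → ℕ) → List ℕ → ℕ → ℕ
τ*ˡ-cost cτ l b = sum (map (λ a → cτ a b) l)

τ*ʳ-cost : (ℕ → ℕ → ℕ) → ℕ → List ℕ → ℕ
τ*ʳ-cost cτ b l = sum (map (cτ b) l)

δ*-cost : (ℕ → ℕ → ℕ) → (ℕ → ℕ) → List ℕ → ℕ
δ*-cost cτ cδ []      = 0
δ*-cost cτ cδ (a ∷ l) = cδ a + δ*-cost cτ cδ l + τ*ʳ-cost cτ a l

ε*-cost : (ℕ → ℕ) → List ℕ → ℕ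
ε*-cost cε l = sum (map cε l)

module StructureCells {S : Sig2} (K : Interp S)
  (weight : Fin (Sig2.nC S) → ℕ)
  (φ-con : ∀ c x → vals S (Interp.φ₂ K (con c) x) ≡ (sum (vals S x) + weight c) ∷ [])
  (φ-δ : ∀ ξ x → vals S (Interp.φ₂ K (δ ξ) x) ≡ vals S x ++ vals S x)
  (φ-τ : ∀ ξ ζ (x : Σ ℕ (Interp.X K ξ)) (y : Σ ℕ (Interp.X K ζ)) →
         vals S (Interp.φ₂ K (τ ξ ζ) (x ∷ y ∷ [])) ≡ proj₁ y ∷ proj₁ x ∷ [])
  (∂-con : ∀ c x → Interp.∂₂ K (con c) x ≡ 0)
  (cτ : ℕ → ℕ → ℕ)
  (∂-τ : ∀ ξ ζ (x : Σ ℕ (Interp.X K ξ)) (y : Σ ℕ (Interp.X K ζ)) →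
         Interp.∂₂ K (τ ξ ζ) (x ∷ y ∷ []) ≡ cτ (proj₁ x) (proj₁ y))
  (cδ : ℕ → ℕ)
  (∂-δ : ∀ ξ (x : Σ ℕ (Interp.X K ξ)) → Interp.∂₂ K (δ ξ) (x ∷ []) ≡ cδ (proj₁ x))
  (cε : ℕ → ℕ)
  (∂-ε : ∀ ξ (x : Σ ℕ (Interp.X K ξ)) → Interp.∂₂ K (ε ξ) (x ∷ []) ≡ cε (proj₁ x))
  where
  open Interp K
  open Sig2 S using (csrc; ctgt)
  open Elements {S} {X}
  open Functoriality K
  open ≡-Reasoning

  private
    E : List (C1 S) → Set
    E = Elt S X

  φ₂-τ-++⁺ : ∀ {ξ ζ} (w : E [ ξ ]) (v : E [ ζ ]) → φ₂ (τ ξ ζ) (++⁺ w v) ≐ ++⁺ v w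
  φ₂-τ-++⁺ (x ∷ []) (y ∷ []) = φ-τ _ _ x y

  ∂₂-τ-++⁺ : ∀ {ξ ζ m n} (w : E [ ξ ]) (v : E [ ζ ]) → vals S w ≡ m ∷ [] → vals S v ≡ n ∷ [] →
             ∂₂ (τ ξ ζ) (++⁺ w v) ≡ cτ m n
  ∂₂-τ-++⁺ (x ∷ []) (y ∷ []) refl refl = ∂-τ _ _ x y

  ∂₂-δ-single : ∀ {ξ m} (w : E [ ξ ]) → vals S w ≡ m ∷ [] → ∂₂ (δ ξ) w ≡ cδ m
  ∂₂-δ-single (x ∷ []) refl = ∂-δ _ x

  ∂₂-ε-single : ∀ {ξ m} (w : E [ ξ ]) → vals S w ≡ m ∷ [] → ∂₂ (ε ξ) w ≡ cε m
  ∂₂-ε-single (x ∷ []) refl = ∂-ε _ x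

  τ-⋆₀-idp : ∀ ξ ζ {u} (x : Σ ℕ (X ξ)) (y : Σ ℕ (X ζ)) (a : E u) →
             vals S (φ (gen (τ ξ ζ) ⋆₀ idp u) (x ∷ y ∷ a)) ≡ proj₁ y ∷ proj₁ x ∷ vals S a
  τ-⋆₀-idp ξ ζ x y a =
    trans (vals-++⁺ (φ₂ (τ ξ ζ) (x ∷ y ∷ [])) a) (cong (_++ vals S a) (φ-τ ξ ζ x y))

  τ*ˡ-φ : ∀ u ζ (a : E u) (p : Σ ℕ (X ζ)) →
          vals S (φ (τ*ˡ S u ζ) (++⁺ a (p ∷ []))) ≡ proj₁ p ∷ vals S a
  τ*ˡ-φ []      ζ []      p = refl
  τ*ˡ-φ (ξ ∷ u) ζ (q ∷ a) p =
    trans (φ-resp-≐ (gen (τ ξ ζ) ⋆₀ idp u) (cong (proj₁ q ∷_) (τ*ˡ-φ u ζ a p)))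
          (τ-⋆₀-idp ξ ζ q p a)

  τ*ˡ-∂ : ∀ u ζ (a : E u) (p : Σ ℕ (X ζ)) →
          ∂ (τ*ˡ S u ζ) (++⁺ a (p ∷ [])) ≡ τ*ˡ-cost cτ (vals S a) (proj₁ p)
  τ*ˡ-∂ []      ζ []      p = refl
  τ*ˡ-∂ (ξ ∷ u) ζ (q ∷ a) p = begin
    ∂ (τ*ˡ S u ζ) z + ∂ (gen (τ ξ ζ) ⋆₀ idp u) (q ∷ φ (τ*ˡ S u ζ) z)
      ≡⟨ cong₂ _+_ (τ*ˡ-∂ u ζ a p)
                   (∂-resp-≐ (gen (τ ξ ζ) ⋆₀ idp u) (cong (proj₁ q ∷_) (τ*ˡ-φ u ζ a p))) ⟩
    τ*ˡ-cost cτ (vals S a) (proj₁ p) + (∂₂ (τ ξ ζ) (q ∷ p ∷ []) + 0)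
      ≡⟨ cong (τ*ˡ-cost cτ (vals S a) (proj₁ p) +_) (trans (+-identityʳ _) (∂-τ ξ ζ q p)) ⟩
    τ*ˡ-cost cτ (vals S a) (proj₁ p) + cτ (proj₁ q) (proj₁ p)
      ≡⟨ +-comm (τ*ˡ-cost cτ (vals S a) (proj₁ p)) _ ⟩
    τ*ˡ-cost cτ (vals S (q ∷ a)) (proj₁ p) ∎
    where
    z = ++⁺ a (p ∷ [])

  τ*ʳ-φ : ∀ ζ u (p : Σ ℕ (X ζ)) (a : E u) → vals S (φ (τ*ʳ S ζ u) (p ∷ a)) ≡ vals S a ++ proj₁ p ∷ []
  τ*ʳ-φ ζ []      p []      = refl
  τ*ʳ-φ ζ (ξ ∷ u) p (q ∷ a) = begin
    vals S (φ (idp [ ξ ] ⋆₀ τ*ʳ S ζ u) (φ (gen (τ ζ ξ) ⋆₀ idp u) (p ∷ q ∷ a)))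
      ≡⟨ φ-resp-≐ (idp [ ξ ] ⋆₀ τ*ʳ S ζ u) {y = q ∷ p ∷ a} (τ-⋆₀-idp ζ ξ p q a) ⟩
    vals S (φ (idp [ ξ ] ⋆₀ τ*ʳ S ζ u) (q ∷ p ∷ a))
      ≡⟨ cong (proj₁ q ∷_) (τ*ʳ-φ ζ u p a) ⟩
    proj₁ q ∷ vals S a ++ proj₁ p ∷ [] ∎

  τ*ʳ-∂ : ∀ ζ u (p : Σ ℕ (X ζ)) (a : E u) →
          ∂ (τ*ʳ S ζ u) (p ∷ a) ≡ τ*ʳ-cost cτ (proj₁ p) (vals S a)
  τ*ʳ-∂ ζ []      p []      = refl
  τ*ʳ-∂ ζ (ξ ∷ u) p (q ∷ a) =
    cong₂ _+_ (trans (+-identityʳ _) (∂-τ ζ ξ p q)) (begin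
      ∂ (idp [ ξ ] ⋆₀ τ*ʳ S ζ u) (φ (gen (τ ζ ξ) ⋆₀ idp u) (p ∷ q ∷ a))
        ≡⟨ ∂-resp-≐ (idp [ ξ ] ⋆₀ τ*ʳ S ζ u) {y = q ∷ p ∷ a} (τ-⋆₀-idp ζ ξ p q a) ⟩
      ∂ (idp [ ξ ] ⋆₀ τ*ʳ S ζ u) (q ∷ p ∷ a)
        ≡⟨ τ*ʳ-∂ ζ u p a ⟩
      τ*ʳ-cost cτ (proj₁ p) (vals S a) ∎)

  δ*-φ : ∀ u (a : E u) → vals S (φ (δ* S u) a) ≡ vals S a ++ vals S a

  δ⋆₀δ*-φ : ∀ ξ u (q : Σ ℕ (X ξ)) (a : E u) →
            φ (gen (δ ξ) ⋆₀ δ* S u) (q ∷ a) ≐ q ∷ q ∷ ++⁺ a a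
  δ⋆₀δ*-φ ξ u q a =
    ++⁺-≐ {a' = q ∷ q ∷ []} (φ-δ ξ (q ∷ [])) (trans (δ*-φ u a) (sym (vals-++⁺ a a)))

  δ*-φ []      []      = refl
  δ*-φ (ξ ∷ u) (q ∷ a) = begin
    vals S (φ (castT S e G) y)
      ≡⟨ φ-castT e G y ⟩
    vals S (φ G y)
      ≡⟨ φ-resp-≐ G {y = q ∷ q ∷ ++⁺ a a} (δ⋆₀δ*-φ ξ u q a) ⟩
    proj₁ q ∷ vals S (φ (τ*ʳ S ξ u ⋆₀ idp u) (++⁺ (q ∷ a) a))
      ≡⟨ cong (λ y → proj₁ q ∷ vals S y) (φ-⋆₀-++⁺ (τ*ʳ S ξ u) (idp u) (q ∷ a) a) ⟩
    proj₁ q ∷ vals S (++⁺ (φ (τ*ʳ S ξ u) (q ∷ a)) a)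
      ≡⟨ cong (proj₁ q ∷_) (vals-++⁺ (φ (τ*ʳ S ξ u) (q ∷ a)) a) ⟩
    proj₁ q ∷ vals S (φ (τ*ʳ S ξ u) (q ∷ a)) ++ vals S a
      ≡⟨ cong (λ l → proj₁ q ∷ l ++ vals S a) (τ*ʳ-φ ξ u q a) ⟩
    proj₁ q ∷ (vals S a ++ proj₁ q ∷ []) ++ vals S a
      ≡⟨ cong (proj₁ q ∷_) (++-assoc (vals S a) _ _) ⟩
    proj₁ q ∷ vals S a ++ proj₁ q ∷ vals S a ∎
    where
    G = idp [ ξ ] ⋆₀ (τ*ʳ S ξ u ⋆₀ idp u)
    e = cong (ξ ∷_) (++-assoc u [ ξ ] u)
    y = φ (gen (δ ξ) ⋆₀ δ* S u) (q ∷ a)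

  δ*-∂ : ∀ u (a : E u) → ∂ (δ* S u) a ≡ δ*-cost cτ cδ (vals S a)
  δ*-∂ []      []      = refl
  δ*-∂ (ξ ∷ u) (q ∷ a) = begin
    ∂₂ (δ ξ) (q ∷ []) + ∂ (δ* S u) a + ∂ (castT S e G) y
      ≡⟨ cong₂ _+_ (cong₂ _+_ (∂-δ ξ q) (δ*-∂ u a)) (∂-castT e G y) ⟩
    cδ (proj₁ q) + δ*-cost cτ cδ (vals S a) + ∂ G y
      ≡⟨ cong (cδ (proj₁ q) + δ*-cost cτ cδ (vals S a) +_) (begin
           ∂ G y
             ≡⟨ ∂-resp-≐ G {y = q ∷ q ∷ ++⁺ a a} (δ⋆₀δ*-φ ξ u q a) ⟩
           ∂ (τ*ʳ S ξ u ⋆₀ idp u) (++⁺ (q ∷ a) a)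
             ≡⟨ ∂-⋆₀-++⁺ (τ*ʳ S ξ u) (idp u) (q ∷ a) a ⟩
           ∂ (τ*ʳ S ξ u) (q ∷ a) + 0
             ≡⟨ trans (+-identityʳ _) (τ*ʳ-∂ ξ u q a) ⟩
           τ*ʳ-cost cτ (proj₁ q) (vals S a) ∎) ⟩
    δ*-cost cτ cδ (vals S (q ∷ a)) ∎
    where
    G = idp [ ξ ] ⋆₀ (τ*ʳ S ξ u ⋆₀ idp u)
    e = cong (ξ ∷_) (++-assoc u [ ξ ] u)
    y = φ (gen (δ ξ) ⋆₀ δ* S u) (q ∷ a)

  ε*-∂ : ∀ u (a : E u) → ∂ (ε* S u) a ≡ ε*-cost cε (vals S a)
  ε*-∂ []      []      = refl
  ε*-∂ (ξ ∷ u) (q ∷ a) = cong₂ _+_ (∂-ε ξ q) (ε*-∂ u a)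

  τˡ-compatible : ∀ {_◁_ : ℕ → ℕ → Set} →
                  (∀ c l b → 1 ≤ b → τ*ˡ-cost cτ l b ◁ cτ (sum l + weight c) b) →
                  ∀ c ζ → Compatible _◁_ (str-τl S c ζ)
  τˡ-compatible {_◁_} cost◁ c ζ =
      ++⁺-elim u (λ z → φ tgt z ⊑ φ src z) (λ { a (p ∷ []) → ≐⇒⊑ (φ-eq a p) })
    , ++⁺-elim u (λ z → ∂ tgt z ◁ ∂ src z) (λ { a (p ∷ []) →
        subst₂ _◁_ (sym (tgt-∂ a p)) (sym (src-∂ a p)) (cost◁ c (vals S a) (proj₁ p) (X-pos ζ _ (proj₂ p))) })
    where
    u = csrc c
    ξ = ctgt c
    src = Cell3.src (str-τl S c ζ)
    tgt = Cell3.tgt (str-τl S c ζ)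
    con⋆₀ζ-φ : ∀ a (p : Σ ℕ (X ζ)) →
               φ (gen (con c) ⋆₀ idp [ ζ ]) (++⁺ a (p ∷ [])) ≡ ++⁺ (φ₂ (con c) a) (p ∷ [])
    con⋆₀ζ-φ a p = φ-⋆₀-++⁺ (gen (con c)) (idp [ ζ ]) a (p ∷ [])
    φ-eq : ∀ a p → φ tgt (++⁺ a (p ∷ [])) ≐ φ src (++⁺ a (p ∷ []))
    φ-eq a p = begin
      vals S (φ (idp [ ζ ] ⋆₀ gen (con c)) (φ (τ*ˡ S u ζ) (++⁺ a (p ∷ []))))
        ≡⟨ φ-resp-≐ (idp [ ζ ] ⋆₀ gen (con c)) {y = p ∷ a} (τ*ˡ-φ u ζ a p) ⟩
      proj₁ p ∷ vals S (φ₂ (con c) a)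
        ≡⟨ sym (φ₂-τ-++⁺ (φ₂ (con c) a) (p ∷ [])) ⟩
      vals S (φ₂ (τ ξ ζ) (++⁺ (φ₂ (con c) a) (p ∷ [])))
        ≡⟨ cong (vals S ∘ φ₂ (τ ξ ζ)) (sym (con⋆₀ζ-φ a p)) ⟩
      vals S (φ src (++⁺ a (p ∷ []))) ∎
    tgt-∂ : ∀ a p → ∂ tgt (++⁺ a (p ∷ [])) ≡ τ*ˡ-cost cτ (vals S a) (proj₁ p)
    tgt-∂ a p = begin
      ∂ (τ*ˡ S u ζ) z + ∂ (idp [ ζ ] ⋆₀ gen (con c)) (φ (τ*ˡ S u ζ) z)
        ≡⟨ cong₂ _+_ (τ*ˡ-∂ u ζ a p) (∂-resp-≐ (idp [ ζ ] ⋆₀ gen (con c)) {y = p ∷ a} (τ*ˡ-φ u ζ a p)) ⟩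
      τ*ˡ-cost cτ (vals S a) (proj₁ p) + ∂₂ (con c) a
        ≡⟨ cong (τ*ˡ-cost cτ (vals S a) (proj₁ p) +_) (∂-con c a) ⟩
      τ*ˡ-cost cτ (vals S a) (proj₁ p) + 0
        ≡⟨ +-identityʳ _ ⟩
      τ*ˡ-cost cτ (vals S a) (proj₁ p) ∎
      where
      z = ++⁺ a (p ∷ [])
    src-∂ : ∀ a p → ∂ src (++⁺ a (p ∷ [])) ≡ cτ (sum (vals S a) + weight c) (proj₁ p)
    src-∂ a p =
      cong₂ _+_ (trans (∂-⋆₀-++⁺ (gen (con c)) (idp [ ζ ]) a (p ∷ [])) (trans (+-identityʳ _) (∂-con c a)))
                (trans (cong (∂₂ (τ ξ ζ)) (con⋆₀ζ-φ a p))
                       (∂₂-τ-++⁺ (φ₂ (con c) a) (p ∷ []) (φ-con c a) refl))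

  τʳ-compatible : ∀ {_◁_ : ℕ → ℕ → Set} →
                  (∀ c b l → 1 ≤ b → τ*ʳ-cost cτ b l ◁ cτ b (sum l + weight c)) →
                  ∀ c ζ → Compatible _◁_ (str-τr S c ζ)
  τʳ-compatible {_◁_} cost◁ c ζ =
      (λ { (p ∷ a) → ≐⇒⊑ (φ-eq p a) })
    , (λ { (p ∷ a) → subst₂ _◁_ (sym (tgt-∂ p a)) (sym (src-∂ p a))
                                (cost◁ c (proj₁ p) (vals S a) (X-pos ζ _ (proj₂ p))) })
    where
    u = csrc c
    ξ = ctgt c
    con⋆₀ζ = gen (con c) ⋆₀ idp [ ζ ]
    τ*ʳ-φ-≐ : ∀ p a → φ (τ*ʳ S ζ u) (p ∷ a) ≐ ++⁺ a (p ∷ [])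
    τ*ʳ-φ-≐ p a = trans (τ*ʳ-φ ζ u p a) (sym (vals-++⁺ a (p ∷ [])))
    φ-eq : ∀ p a → φ (Cell3.tgt (str-τr S c ζ)) (p ∷ a) ≐ φ (Cell3.src (str-τr S c ζ)) (p ∷ a)
    φ-eq p a = begin
      vals S (φ con⋆₀ζ (φ (τ*ʳ S ζ u) (p ∷ a)))
        ≡⟨ φ-resp-≐ con⋆₀ζ {y = ++⁺ a (p ∷ [])} (τ*ʳ-φ-≐ p a) ⟩
      vals S (φ con⋆₀ζ (++⁺ a (p ∷ [])))
        ≡⟨ cong (vals S) (φ-⋆₀-++⁺ (gen (con c)) (idp [ ζ ]) a (p ∷ [])) ⟩
      vals S (++⁺ (φ₂ (con c) a) (p ∷ []))
        ≡⟨ sym (φ₂-τ-++⁺ (p ∷ []) (φ₂ (con c) a)) ⟩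
      vals S (φ₂ (τ ζ ξ) (p ∷ φ₂ (con c) a)) ∎
    tgt-∂ : ∀ p a → ∂ (Cell3.tgt (str-τr S c ζ)) (p ∷ a) ≡ τ*ʳ-cost cτ (proj₁ p) (vals S a)
    tgt-∂ p a = begin
      ∂ (τ*ʳ S ζ u) (p ∷ a) + ∂ con⋆₀ζ (φ (τ*ʳ S ζ u) (p ∷ a))
        ≡⟨ cong₂ _+_ (τ*ʳ-∂ ζ u p a) (∂-resp-≐ con⋆₀ζ {y = ++⁺ a (p ∷ [])} (τ*ʳ-φ-≐ p a)) ⟩
      τ*ʳ-cost cτ (proj₁ p) (vals S a) + ∂ con⋆₀ζ (++⁺ a (p ∷ []))
        ≡⟨ cong (τ*ʳ-cost cτ (proj₁ p) (vals S a) +_)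
                (trans (∂-⋆₀-++⁺ (gen (con c)) (idp [ ζ ]) a (p ∷ [])) (trans (+-identityʳ _) (∂-con c a))) ⟩
      τ*ʳ-cost cτ (proj₁ p) (vals S a) + 0
        ≡⟨ +-identityʳ _ ⟩
      τ*ʳ-cost cτ (proj₁ p) (vals S a) ∎
    src-∂ : ∀ p a → ∂ (Cell3.src (str-τr S c ζ)) (p ∷ a) ≡ cτ (proj₁ p) (sum (vals S a) + weight c)
    src-∂ p a = cong₂ _+_ (∂-con c a) (∂₂-τ-++⁺ (p ∷ []) (φ₂ (con c) a) refl (φ-con c a))

  δ-compatible : ∀ {_◁_ : ℕ → ℕ → Set} →
                 (∀ c l → δ*-cost cτ cδ l ◁ cδ (sum l + weight c)) →
                 ∀ c → Compatible _◁_ (str-δ S c)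
  δ-compatible {_◁_} cost◁ c =
      (λ a → ≐⇒⊑ (φ-eq a))
    , (λ a → subst₂ _◁_ (sym (tgt-∂ a)) (sym (src-∂ a)) (cost◁ c (vals S a)))
    where
    u = csrc c
    ξ = ctgt c
    con⋆₀con = gen (con c) ⋆₀ gen (con c)
    δ*-φ-≐ : ∀ a → φ (δ* S u) a ≐ ++⁺ a a
    δ*-φ-≐ a = trans (δ*-φ u a) (sym (vals-++⁺ a a))
    φ-eq : ∀ a → φ (Cell3.tgt (str-δ S c)) a ≐ φ (Cell3.src (str-δ S c)) a
    φ-eq a = begin
      vals S (φ con⋆₀con (φ (δ* S u) a))
        ≡⟨ φ-resp-≐ con⋆₀con {y = ++⁺ a a} (δ*-φ-≐ a) ⟩
      vals S (φ con⋆₀con (++⁺ a a))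
        ≡⟨ cong (vals S) (φ-⋆₀-++⁺ (gen (con c)) (gen (con c)) a a) ⟩
      vals S (++⁺ (φ₂ (con c) a) (φ₂ (con c) a))
        ≡⟨ vals-++⁺ (φ₂ (con c) a) (φ₂ (con c) a) ⟩
      vals S (φ₂ (con c) a) ++ vals S (φ₂ (con c) a)
        ≡⟨ sym (φ-δ ξ (φ₂ (con c) a)) ⟩
      vals S (φ₂ (δ ξ) (φ₂ (con c) a)) ∎
    tgt-∂ : ∀ a → ∂ (Cell3.tgt (str-δ S c)) a ≡ δ*-cost cτ cδ (vals S a)
    tgt-∂ a = begin
      ∂ (δ* S u) a + ∂ con⋆₀con (φ (δ* S u) a)
        ≡⟨ cong₂ _+_ (δ*-∂ u a) (∂-resp-≐ con⋆₀con {y = ++⁺ a a} (δ*-φ-≐ a)) ⟩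
      δ*-cost cτ cδ (vals S a) + ∂ con⋆₀con (++⁺ a a)
        ≡⟨ cong (δ*-cost cτ cδ (vals S a) +_)
                (trans (∂-⋆₀-++⁺ (gen (con c)) (gen (con c)) a a) (cong₂ _+_ (∂-con c a) (∂-con c a))) ⟩
      δ*-cost cτ cδ (vals S a) + 0
        ≡⟨ +-identityʳ _ ⟩
      δ*-cost cτ cδ (vals S a) ∎
    src-∂ : ∀ a → ∂ (Cell3.src (str-δ S c)) a ≡ cδ (sum (vals S a) + weight c)
    src-∂ a = cong₂ _+_ (∂-con c a) (∂₂-δ-single (φ₂ (con c) a) (φ-con c a))

  ε-compatible : ∀ {_◁_ : ℕ → ℕ → Set} →
                 (∀ c l → ε*-cost cε l ◁ cε (sum l + weight c)) →
                 ∀ c → Compatible _◁_ (str-ε S c)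
  ε-compatible {_◁_} cost◁ c =
      (λ a → ≐⇒⊑ (E[]-≐ (φ (ε* S (csrc c)) a) _))
    , (λ a → subst₂ _◁_ (sym (ε*-∂ (csrc c) a)) (sym (src-∂ a)) (cost◁ c (vals S a)))
    where
    src-∂ : ∀ a → ∂ (Cell3.src (str-ε S c)) a ≡ cε (sum (vals S a) + weight c)
    src-∂ a = cong₂ _+_ (∂-con c a) (∂₂-ε-single (φ₂ (con c) a) (φ-con c a))

  structurally-compatible :
    ∀ {_◁_ : ℕ → ℕ → Set} →
    (∀ c l b → 1 ≤ b → τ*ˡ-cost cτ l b ◁ cτ (sum l + weight c) b) →
    (∀ c b l → 1 ≤ b → τ*ʳ-cost cτ b l ◁ cτ b (sum l + weight c)) →
    (∀ c l → δ*-cost cτ cδ l ◁ cδ (sum l + weight c)) →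
    (∀ c l → ε*-cost cε l ◁ cε (sum l + weight c)) →
    StructurallyCompatible K _◁_
  structurally-compatible {_◁_} τˡ◁ τʳ◁ δ◁ ε◁ = record
    { τˡ-cell = τˡ-compatible {_◁_} τˡ◁
    ; τʳ-cell = τʳ-compatible {_◁_} τʳ◁
    ; δ-cell  = δ-compatible {_◁_} δ◁
    ; ε-cell  = ε-compatible {_◁_} ε◁
    }

sum-map-0 : ∀ {A : Set} (l : List A) → sum (map (λ _ → 0) l) ≡ 0
sum-map-0 []      = refl
sum-map-0 (_ ∷ l) = sum-map-0 l

δ*-cost-0 : ∀ l → δ*-cost (λ _ _ → 0) (λ _ → 0) l ≡ 0
δ*-cost-0 []      = refl
δ*-cost-0 (_ ∷ l) = cong₂ _+_ (δ*-cost-0 l) (sum-map-0 l)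

sumE≡sum∘vals : ∀ {S X u} (x : Elt S X u) → sumE S x ≡ sum (vals S x)
sumE≡sum∘vals []            = refl
sumE≡sum∘vals ((n , _) ∷ x) = cong (n +_) (sumE≡sum∘vals x)

cartesian⇒structurally-compatible : ∀ {S} (I : Interp S) → Additive S I → Cartesian S I →
                                    StructurallyCompatible I _≤_
cartesian⇒structurally-compatible {S} I additive (φ-δ , φ-τ , ∂-con , ∂-τ , ∂-δ , ∂-ε) =
  structurally-compatible (λ _ l _ _ → ≤-reflexive (sum-map-0 l)) (λ _ _ l _ → ≤-reflexive (sum-map-0 l))
                          (λ _ l → ≤-reflexive (δ*-cost-0 l)) (λ _ l → ≤-reflexive (sum-map-0 l))
  where
  open Interp I
  weight : Fin (Sig2.nC S) → ℕ
  weight c = proj₁ (additive c)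
  φ-con : ∀ c x → vals S (φ₂ (con c) x) ≡ (sum (vals S x) + weight c) ∷ []
  φ-con c x = trans (proj₂ (proj₂ (additive c)) x) (cong (λ n → (n + weight c) ∷ []) (sumE≡sum∘vals x))
  open StructureCells I weight φ-con φ-δ φ-τ ∂-con
    (λ _ _ → 0) (λ ξ ζ x y → ∂-τ ξ ζ (x ∷ y ∷ []))
    (λ _ → 0) (λ ξ x → ∂-δ ξ (x ∷ []))
    (λ _ → 0) (λ ξ x → ∂-ε ξ (x ∷ []))

τ*ˡ-cost-* : ∀ l b → τ*ˡ-cost _*_ l b ≡ sum l * b
τ*ˡ-cost-* []      b = refl
τ*ˡ-cost-* (a ∷ l) b = trans (cong (a * b +_) (τ*ˡ-cost-* l b)) (sym (*-distribʳ-+ b a (sum l)))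

τ*ʳ-cost-* : ∀ b l → τ*ʳ-cost _*_ b l ≡ b * sum l
τ*ʳ-cost-* b []      = sym (*-zeroʳ b)
τ*ʳ-cost-* b (a ∷ l) = trans (cong (b * a +_) (τ*ʳ-cost-* b l)) (sym (*-distribˡ-+ b a (sum l)))

δ*-cost-*-≤ : ∀ l → δ*-cost _*_ (λ a → a * a) l ≤ sum l * sum l
δ*-cost-*-≤ []      = z≤n
δ*-cost-*-≤ (a ∷ l) = let s = sum l in begin
  a * a + δ*-cost _*_ (λ a → a * a) l + τ*ʳ-cost _*_ a l
    ≤⟨ +-mono-≤ (+-monoʳ-≤ (a * a) (δ*-cost-*-≤ l)) (≤-reflexive (τ*ʳ-cost-* a l)) ⟩
  a * a + s * s + a * s
    ≤⟨ m≤m+n _ (s * a) ⟩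
  a * a + s * s + a * s + s * a
    ≡⟨ square-expansion a s ⟩
  (a + s) * (a + s) ∎
  where
  open ≤-Reasoning
  square-expansion : ∀ a s → a * a + s * s + a * s + s * a ≡ (a + s) * (a + s)
  square-expansion = solve-∀

module Size (S : Sig2) where
  open Sig2 S using (ftgt)

  Positive : C1 S → ℕ → Set
  Positive _ n = 1 ≤ n

  open Elements {S} {Positive}

  private
    E : List (C1 S) → Set
    E = Elt S Positive

  φ₂ : (a : C2 S) → E (src2 S a) → E (tgt2 S a)
  φ₂ (τ ξ ζ) (x ∷ y ∷ []) = y ∷ x ∷ []
  φ₂ (δ ξ)   (x ∷ [])     = x ∷ x ∷ []
  φ₂ (ε ξ)   _            = []
  φ₂ (con c) x            = (sum (vals S x) + 1 , m≤n+m 1 _) ∷ []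
  φ₂ (fun f) _            = All.universal (λ _ → 1 , ≤-refl) (ftgt f)

  φ₂-mono : ∀ a {x y} → x ⊑ y → φ₂ a x ⊑ φ₂ a y
  φ₂-mono (τ ξ ζ) {_ ∷ _ ∷ []} {_ ∷ _ ∷ []} (x≤ ∷ y≤ ∷ []) = y≤ ∷ x≤ ∷ []
  φ₂-mono (δ ξ)   {_ ∷ []}     {_ ∷ []}     (x≤ ∷ [])      = x≤ ∷ x≤ ∷ []
  φ₂-mono (ε ξ)   _     = []
  φ₂-mono (con c) x≤y   = +-monoˡ-≤ 1 (Pointwise.foldr⁺ +-mono-≤ ≤-refl x≤y) ∷ []
  φ₂-mono (fun f) _     = ⊑-refl

  ∂₂ : (a : C2 S) → E (src2 S a) → ℕ
  ∂₂ (τ ξ ζ) (x ∷ y ∷ []) = proj₁ x * proj₁ y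
  ∂₂ (δ ξ)   (x ∷ [])     = proj₁ x * proj₁ x
  ∂₂ (ε ξ)   (x ∷ [])     = proj₁ x
  ∂₂ (con c) _            = 0
  ∂₂ (fun f) _            = 0

  ∂₂-mono : ∀ a {x y} → x ⊑ y → ∂₂ a x ≤ ∂₂ a y
  ∂₂-mono (τ ξ ζ) {_ ∷ _ ∷ []} {_ ∷ _ ∷ []} (x≤ ∷ y≤ ∷ []) = *-mono-≤ x≤ y≤
  ∂₂-mono (δ ξ)   {_ ∷ []}     {_ ∷ []}     (x≤ ∷ [])      = *-mono-≤ x≤ x≤
  ∂₂-mono (ε ξ)   {_ ∷ []}     {_ ∷ []}     (x≤ ∷ [])      = x≤
  ∂₂-mono (con c) _ = z≤n
  ∂₂-mono (fun f) _ = z≤n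

-- Function cells are interpreted arbitrarily: computation steps are already
-- accounted for by the given interpretation.
sizeInterp : (S : Sig2) → Interp S
sizeInterp S = record
  { X = Positive ; X-pos = λ _ _ → id ; X-ne = λ _ → 1 , ≤-refl
  ; φ₂ = φ₂ ; φ₂-mono = φ₂-mono ; ∂₂ = ∂₂ ; ∂₂-mono = ∂₂-mono }
  where open Size S

sizeInterp-structurally-compatible : ∀ S → StructurallyCompatible (sizeInterp S) _<_
sizeInterp-structurally-compatible S = structurally-compatible τˡ< τʳ< δ< ε<
  where
  open Interp (sizeInterp S)
  φ-δ : ∀ ξ x → vals S (φ₂ (δ ξ) x) ≡ vals S x ++ vals S x
  φ-δ _ (_ ∷ []) = refl
  open StructureCells (sizeInterp S) (λ _ → 1) (λ _ _ → refl) φ-δ (λ _ _ _ _ → refl)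
    (λ _ _ → refl) _*_ (λ _ _ _ _ → refl) (λ a → a * a) (λ _ _ → refl) (λ a → a) (λ _ _ → refl)
  s<s+1 : ∀ s → s < s + 1
  s<s+1 s = m<m+n s z<s
  τˡ< : ∀ c l b → 1 ≤ b → τ*ˡ-cost _*_ l b < (sum l + 1) * b
  τˡ< _ l b 1≤b =
    subst (_< (sum l + 1) * b) (sym (τ*ˡ-cost-* l b)) (*-monoˡ-< b {{>-nonZero 1≤b}} (s<s+1 (sum l)))
  τʳ< : ∀ c b l → 1 ≤ b → τ*ʳ-cost _*_ b l < b * (sum l + 1)
  τʳ< _ b l 1≤b =
    subst (_< b * (sum l + 1)) (sym (τ*ʳ-cost-* b l)) (*-monoʳ-< b {{>-nonZero 1≤b}} (s<s+1 (sum l)))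
  δ< : ∀ c l → δ*-cost _*_ (λ a → a * a) l < (sum l + 1) * (sum l + 1)
  δ< _ l = ≤-<-trans (δ*-cost-*-≤ l) (*-mono-< (s<s+1 (sum l)) (s<s+1 (sum l)))
  ε< : ∀ c l → ε*-cost (λ a → a) l < sum l + 1
  ε< _ l = subst (λ l′ → sum l′ < sum l + 1) (sym (map-id l)) (s<s+1 (sum l))

no-infinite-descent : ∀ {a ℓ} {A : Set a} {_<_ : Rel A ℓ} → WellFounded _<_ →
                      (f : ℕ → A) → ¬ (∀ n → f (suc n) < f n)
no-infinite-descent {_<_ = _<_} wf f descending =
  descent∧wf⇒empty descent wf (f 0) (f , refl , descending)
  where
  descent : Descent _<_ (λ x → ∃[ g ] InfiniteDescendingSequenceFrom _<_ g x)
  descent (g , refl , g↓) = g 1 , g↓ 0 , g ∘ suc , refl , g↓ ∘ suc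

_<ₗₑₓ_ : Rel (ℕ × ℕ) _
_<ₗₑₓ_ = ×-Lex _≤_ _<_ _<_

<ₗₑₓ-wellFounded : WellFounded _<ₗₑₓ_
<ₗₑₓ-wellFounded = ×-wellFounded' ≤-trans (λ y≤z x<y → <-≤-trans x<y y≤z) <-wellFounded <-wellFounded

module LexicographicDescent (P : Program) (I : Interp (Program.sig P)) where
  open Program P using (sig)
  open Functoriality using (Compatible)
  open StructurallyCompatible

  J : Interp sig
  J = sizeInterp sig

  inhabitant : (K : Interp sig) → ∀ u → Elt sig (Interp.X K) u
  inhabitant K = All.universal (Interp.X-ne K)

  measure : ∀ {u v} → Path2 sig u v → ℕ × ℕ
  measure {u} h = Interp.∂ I h (inhabitant I u) , Interp.∂ J h (inhabitant J u)

  step-decreases : StructurallyCompatible I _≤_ → (∀ r → Compatible I _<_ (cell3 P (comp r))) →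
                   ∀ {u v} {h h' : Path2 sig u v} → Step P h h' → measure h' <ₗₑₓ measure h
  step-decreases I-structure I-computation {u} s =
    Sum.map (λ I< → RI.∂-step {_<_} <-mono s I< x)
            (λ (I≤ , J<) → RI.∂-step {_≤_} ≤-mono s I≤ x , RJ.∂-step {_<_} <-mono s J< y)
            (decreasing (rule s))
    where
    module RI = Rewriting P I
    module RJ = Rewriting P J
    x = inhabitant I u
    y = inhabitant J u
    ≤-mono : ∀ {a b c d} m → a ≤ b → c ≤ d → m + (a + c) ≤ m + (b + d)
    ≤-mono m a≤b c≤d = +-monoʳ-≤ m (+-mono-≤ a≤b c≤d)
    <-mono : ∀ {a b c d} m → a < b → c ≤ d → m + (a + c) < m + (b + d)
    <-mono m a<b c≤d = +-monoʳ-< m (+-mono-<-≤ a<b c≤d)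
    J-structure = sizeInterp-structurally-compatible sig
    decreasing : ∀ α → Compatible I _<_ (cell3 P α)
                       ⊎ (Compatible I _≤_ (cell3 P α) × Compatible J _<_ (cell3 P α))
    decreasing (comp r)   = inj₁ (I-computation r)
    decreasing (s-τl c ζ) = inj₂ (τˡ-cell I-structure c ζ , τˡ-cell J-structure c ζ)
    decreasing (s-τr c ζ) = inj₂ (τʳ-cell I-structure c ζ , τʳ-cell J-structure c ζ)
    decreasing (s-δ c)    = inj₂ (δ-cell I-structure c , δ-cell J-structure c)
    decreasing (s-ε c)    = inj₂ (ε-cell I-structure c , ε-cell J-structure c)

proposition3p14 : (P : Program) (I : Interp (Program.sig P))
    → Additive (Program.sig P) I
    → Cartesian (Program.sig P) I
    → (∀ (r : Fin (Program.nR P)) →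
         StrictlyCompatible (Program.sig P) I (compCell3 (Program.sig P) (Program.rules P r)))
    → Terminates P
proposition3p14 P I additive cartesian compatible u v (s , steps) =
  no-infinite-descent <ₗₑₓ-wellFounded (measure ∘ s)
    (λ n → step-decreases (cartesian⇒structurally-compatible I additive cartesian) compatible (steps n))
  where open LexicographicDescent P I
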